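{- For every complexity measure $\psi$ and every table $T\in\mathcal{M}_k^2$, $\psi^s(T)\le S_\psi(T)$.
   Context: Fix an integer $k\ge 2$; $E_k=\{0,\ldots,k-1\}$, $E_2=\{0,1\}$, $\omega=\{0,1,2,\ldots\}$, $P=\{f_i:i\in\omega\}$ a set of attribute names. $\mathcal{M}_k^2$ is the set of rectangular tables filled with numbers from $E_k$, columns labeled with pairwise different attributes from $P$, rows pairwise different, each row labeled with a decision from $E_2$; the table without rows is denoted $\Lambda$. $P(T)$ is the set of column attributes. $\mathcal{M}_k^2\mathcal{C}$ is the set of tables in which all rows have the same decision ($\Lambda$ included). $T(f_{i_1},\delta_1)\cdots(f_{i_m},\delta_m)$ is the table of rows of $T$ having values $\delta_1,\ldots,\delta_m$ in the columns labeled $f_{i_1},\ldots,f_{i_m}$. A $k$-decision tree: finite directed rooted tree with at least two nodes, root and its leaving edges unlabeled, terminal nodes labeled with decisions from $E_2$, other nodes labeled with attributes from $P$ whose leaving edges are labeled with numbers from $E_k$; $P(\Gamma)$ is the set of attributes labeling nodes. For a complete path $\tau=v_1,d_1,\ldots,v_m,d_m,v_{m+1}$ (root to terminal node), $F(\tau)$ is the empty word if $m=1$, else $f_{i_2}\cdots f_{i_m}$ where $v_j$ is labeled $f_{i_j}$; $T(\tau)=T$ if $m=1$, else $T(f_{i_2},\delta_2)\cdots(f_{i_m},\delta_m)$ with $d_j$ labeled $\delta_j$. For $T\notin\mathcal{M}_k^2\mathcal{C}$, a strongly nondeterministic decision tree for $T$: all terminal nodes labeled $1$, $P(\Gamma)\subseteq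 P(T)$, every row with decision $1$ lies in some $T(\tau)$, and for every complete path either $T(\tau)=\Lambda$ or all rows of $T(\tau)$ have decision $1$. Let $B$ be the set of finite words over $P$ (with empty word $\lambda$). A complexity measure is $\psi:B\to\omega$ with $\psi(\alpha)=0$ iff $\alpha=\lambda$, invariant under permutation of letters, $\psi(\alpha_1)\le\psi(\alpha_1\alpha_2)\le\psi(\alpha_1)+\psi(\alpha_2)$. For finite $D\subseteq P$: $\psi(\emptyset)=0$, $\psi(\{f_{i_1},\ldots,f_{i_m}\})=\psi(f_{i_1}\cdots f_{i_m})$. $\psi(\Gamma)=\max_\tau\psi(F(\tau))$ over complete paths. Both parameters are $0$ on $\Lambda$. For $T\ne\Lambda$: $\psi^s(T)=0$ if $T\in\mathcal{M}_k^2\mathcal{C}$ and otherwise the minimum of $\psi(\Gamma)$ over strongly nondeterministic decision trees for $T$; for a row $\bar\delta$ of $T$, $S_\psi(T,\bar\delta)$ is the minimum of $\psi(D)$ over $D\subseteq P(T)$ such that on the columns labeled by $D$ the row $\bar\delta$ differs from all other rows of $T$, and $S_\psi(T)=\max_{\bar\delta}S_\psi(T,\bar\delta)$. -}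

module Defs where

open import Data.Nat using (ℕ; zero; suc; _+_; _≤_; _⊓_; _⊔_; _≡ᵇ_)
open import Data.Bool using (if_then_else_)
open import Data.Fin using (Fin; zero; suc)
import Data.Fin as Fin
open import Data.Vec using (Vec; []; _∷_)
open import Data.Vec.Properties using () renaming (≡-dec to vec-≡-dec)
open import Data.Maybe using (Maybe; just; nothing)
open import Data.Maybe.Properties using () renaming (≡-dec to maybe-≡-dec)
open import Data.List using (List; []; _∷_; _++_; map; length; filter; foldr; [_])
open import Data.List.NonEmpty using (List⁺; toList)
open import Data.List.Membership.Propositional using (_∈_)
open import Data.List.Relation.Unary.All using (All; all?)
open import Data.List.Relation.Unary.Any using (Any; any?)
open import Data.List.Relation.Unary.Unique.Propositional using (Unique)
open import Data.List.Relation.Binary.Permutation.Propositional using (_↭_)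
open import Data.Product using (Σ; _×_; _,_; proj₁; proj₂; ∃)
open import Data.Sum using (_⊎_)
open import Relation.Binary.PropositionalEquality using (_≡_; _≢_)
open import Relation.Nullary using (Dec; ¬?)
open import Relation.Nullary.Decidable using (_→-dec_)

-- Attributes f_i are represented by their indices i ∈ ℕ; words over P are List ℕ.

record ComplexityMeasure : Set where
  field
    ψ       : List ℕ → ℕ
    ψ-zero  : ∀ α → ψ α ≡ 0 → α ≡ []
    ψ-λ     : ψ [] ≡ 0
    ψ-perm  : ∀ {α β} → α ↭ β → ψ α ≡ ψ β
    ψ-mono  : ∀ α₁ α₂ → ψ α₁ ≤ ψ (α₁ ++ α₂)
    ψ-sub   : ∀ α₁ α₂ → ψ (α₁ ++ α₂) ≤ ψ α₁ + ψ α₂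
open ComplexityMeasure public

one : Fin 2
one = suc zero

-- A row: values in the columns (in column order) together with its decision.
Row : ℕ → ℕ → Set
Row k n = Vec (Fin k) n × Fin 2

record Table (k : ℕ) : Set where
  field
    cols  : List ℕ
    colsU : Unique cols
    rows  : List (Row k (length cols))
    rowsU : Unique (map proj₁ rows)
open Table public

val : ∀ {k} (cs : List ℕ) → Vec (Fin k) (length cs) → ℕ → Maybe (Fin k)
val []       []       f = nothing
val (g ∷ cs) (x ∷ xs) f = if f ≡ᵇ g then just x else val cs xs f

-- T ∈ M_k^2 C : all rows have the same decision (Λ included)
Uniform : ∀ {k} → Table k → Set
Uniform T = ∃ λ (d : Fin 2) → All (λ r → proj₂ r ≡ d) (rows T)

-- T(f_{i_1},δ_1)⋯(f_{i_m},δ_m), represented by its list of rows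
restrict : ∀ {k} (T : Table k) → List (ℕ × Fin k) → List (Row k (length (cols T)))
restrict T []             = rows T
restrict T ((f , δ) ∷ p)  =
  filter (λ r → maybe-≡-dec Fin._≟_ (val (cols T) (proj₁ r) f) (just δ)) (restrict T p)

data Node (k : ℕ) : Set where
  leaf : Fin 2 → Node k
  attr : ℕ → List⁺ (Fin k × Node k) → Node k

-- A k-decision tree: an unlabelled root with a nonempty list of (unlabelled) edges.
DTree : ℕ → Set
DTree k = List⁺ (Node k)

data NPath {k : ℕ} : Node k → List (ℕ × Fin k) → Fin 2 → Set where
  leafP : ∀ {d} → NPath (leaf d) [] d
  attrP : ∀ {f es δ c p d} → (δ , c) ∈ toList es → NPath c p d →
          NPath (attr f es) ((f , δ) ∷ p) d

-- complete path τ of Γ: p lists (f_{i_j}, δ_j) for j = 2..m, d is the terminal label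
CPath : ∀ {k} → DTree k → List (ℕ × Fin k) → Fin 2 → Set
CPath Γ p d = Σ _ λ c → c ∈ toList Γ × NPath c p d

F : ∀ {k} → List (ℕ × Fin k) → List ℕ
F p = map proj₁ p

StronglyNondet : ∀ {k} → Table k → DTree k → Set
StronglyNondet T Γ =
  (∀ p d → CPath Γ p d → d ≡ one)
  × (∀ p d → CPath Γ p d → All (λ f → f ∈ cols T) (F p))
  × (∀ r → r ∈ rows T → proj₂ r ≡ one →
       ∃ λ p → ∃ λ d → CPath Γ p d × r ∈ restrict T p)
  × (∀ p d → CPath Γ p d → All (λ r → proj₂ r ≡ one) (restrict T p))

-- ψ(Γ) ≤ x  (ψ(Γ) is the maximum of ψ(F(τ)) over complete paths τ)
ψΓ≤ : ∀ {k} → ComplexityMeasure → DTree k → ℕ → Set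
ψΓ≤ M Γ x = ∀ p d → CPath Γ p d → ψ M (F p) ≤ x

-- ψ^s(T) ≤ x  (ψ^s(T) = 0 for T ∈ M_k^2 C, including Λ; otherwise the
-- minimum of ψ(Γ) over strongly nondeterministic decision trees Γ for T)
ψs≤ : ∀ {k} → ComplexityMeasure → Table k → ℕ → Set
ψs≤ M T x = Uniform T ⊎ (Σ (DTree _) λ Γ → StronglyNondet T Γ × ψΓ≤ M Γ x)

-- all sublists (= subsets, since cols are pairwise different)
sublists : List ℕ → List (List ℕ)
sublists []       = [ [] ]
sublists (x ∷ xs) = map (x ∷_) (sublists xs) ++ sublists xs

Separates : ∀ {k} (T : Table k) → Row k (length (cols T)) → List ℕ → Set
Separates T r D =
  All (λ r' → proj₁ r' ≢ proj₁ r →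
         Any (λ f → val (cols T) (proj₁ r) f ≢ val (cols T) (proj₁ r') f) D)
      (rows T)

separates? : ∀ {k} (T : Table k) (r : Row k (length (cols T))) (D : List ℕ) →
             Dec (Separates T r D)
separates? T r D =
  all? (λ r' → ¬? (vec-≡-dec Fin._≟_ (proj₁ r') (proj₁ r)) →-dec
         any? (λ f → ¬? (maybe-≡-dec Fin._≟_ (val (cols T) (proj₁ r) f)
                                               (val (cols T) (proj₁ r') f))) D)
       (rows T)

-- S_ψ(T, δ̄): minimum of ψ(D) over separating D ⊆ P(T)
-- (D = P(T) always separates since rows are pairwise different, so the
--  default value ψ(P(T)) of the fold does not affect the minimum)
Sψrow : ∀ {k} → ComplexityMeasure → (T : Table k) → Row k (length (cols T)) → ℕ
Sψrow M T r = foldr _⊓_ (ψ M (cols T))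
                (map (ψ M) (filter (separates? T r) (sublists (cols T))))

Sψ : ∀ {k} → ComplexityMeasure → Table k → ℕ
Sψ M T = foldr _⊔_ 0 (map (Sψrow M T) (rows T))

{-# OPTIONS --safe #-}
module Submission where

-- For every row δ̄ with decision 1 choose a set D of columns of minimal ψ on
-- which δ̄ differs from all other rows, and let the root have one branch per
-- such row, a chain asking the attributes of D and following the values of δ̄.
-- Only δ̄ itself reaches the end of its branch, so every branch ends on rows
-- with decision 1, every such row is covered, and the branch of δ̄ costs
-- ψ(D) = S_ψ(T, δ̄) ≤ S_ψ(T).

open import Defs
open import Data.Nat using (ℕ; suc; _≤_; _⊔_; _≡ᵇ_; s≤s; z≤n)
open import Data.Nat.Properties
  using (≡ᵇ⇒≡; ≡⇒≡ᵇ; ⊓-sel; m≤m⊔n; m≤n⇒m≤o⊔n; ≤-reflexive; ≤-trans)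
open import Data.Bool using (true; false)
open import Data.Bool.Properties using (T-≡)
open import Data.Fin using (Fin; zero; suc)
import Data.Fin as Fin
open import Data.Vec using (Vec; []; _∷_)
open import Data.Vec.Properties using () renaming (≡-dec to vec-≡-dec)
open import Data.Maybe using (just; fromMaybe)
open import Data.Maybe.Properties using (just-injective) renaming (≡-dec to maybe-≡-dec)
open import Data.List using (List; []; _∷_; map; filter; foldr; length)
open import Data.List.Properties using (map-∘; map-id)
open import Data.List.NonEmpty using (List⁺; toList; _∷_)
import Data.List.NonEmpty as List⁺
open import Data.List.Membership.Propositional using (_∈_; find)
open import Data.List.Membership.Propositional.Properties
  using (∈-map⁺; ∈-map⁻; ∈-++⁻; ∈-filter⁺; ∈-filter⁻; foldr-selective)
open import Data.List.Relation.Unary.All using (All; []; _∷_; all?)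
import Data.List.Relation.Unary.All as All
open import Data.List.Relation.Unary.All.Properties using (map⁺; map⁻)
open import Data.List.Relation.Unary.All.Properties.Core using (¬All⇒Any¬; All¬⇒¬Any)
open import Data.List.Relation.Unary.Any using (Any; here; there)
open import Data.List.Relation.Unary.AllPairs using (_∷_)
open import Data.List.Relation.Unary.Unique.Propositional using (Unique)
open import Data.Product using (_×_; _,_; proj₁; proj₂; ∃)
open import Data.Sum using (_⊎_; inj₁; inj₂)
open import Function using (id)
open import Function.Bundles using (Equivalence)
open import Relation.Binary.PropositionalEquality
  using (_≡_; _≢_; refl; sym; trans; cong; cong₂; subst)
open import Relation.Nullary using (Dec; yes; no; contradiction)
open import Relation.Nullary.Decidable using (decidable-stable)

val-here : ∀ {k} g (cs : List ℕ) (x : Fin k) xs → val (g ∷ cs) (x ∷ xs) g ≡ just x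
val-here g cs x xs rewrite Equivalence.to T-≡ (≡⇒≡ᵇ g g refl) = refl

val-there : ∀ {k} {g f} (cs : List ℕ) (x : Fin k) xs → g ≢ f →
            val (g ∷ cs) (x ∷ xs) f ≡ val cs xs f
val-there {g = g} {f} cs x xs g≢f with f ≡ᵇ g in eq
... | true  = contradiction (sym (≡ᵇ⇒≡ f g (Equivalence.from T-≡ eq))) g≢f
... | false = refl

∈⇒val≡just : ∀ {k} d {f} (cs : List ℕ) (v : Vec (Fin k) _) → f ∈ cs →
        val cs v f ≡ just (fromMaybe d (val cs v f))
∈⇒val≡just d (g ∷ cs) (x ∷ xs) (here refl) rewrite val-here g cs x xs = refl
∈⇒val≡just d {f} (g ∷ cs) (x ∷ xs) (there f∈cs) with f ≡ᵇ g
... | true  = refl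
... | false = ∈⇒val≡just d cs xs f∈cs

val-injective : ∀ {k} {cs : List ℕ} → Unique cs → (v w : Vec (Fin k) _) →
                All (λ f → val cs v f ≡ val cs w f) cs → v ≡ w
val-injective {cs = []}     _            []       []       _        = refl
val-injective {cs = g ∷ cs} (g∉cs ∷ u) (x ∷ xs) (y ∷ ys) (e ∷ es) =
  cong₂ _∷_ (just-injective (trans (sym (val-here g cs x xs)) (trans e (val-here g cs y ys))))
            (val-injective u xs ys (All.zipWith agree-on-tail (g∉cs , es)))
  where
  agree-on-tail : ∀ {f} → g ≢ f × val (g ∷ cs) (x ∷ xs) f ≡ val (g ∷ cs) (y ∷ ys) f →
                  val cs xs f ≡ val cs ys f
  agree-on-tail (g≢f , e′) =
    trans (sym (val-there cs x xs g≢f)) (trans e′ (val-there cs y ys g≢f))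

cols-separate : ∀ {k} {cs : List ℕ} → Unique cs → {v w : Vec (Fin k) _} → w ≢ v →
                Any (λ f → val cs v f ≢ val cs w f) cs
cols-separate {cs = cs} u {v} {w} w≢v =
  ¬All⇒Any¬ (λ f → maybe-≡-dec Fin._≟_ (val cs v f) (val cs w f)) cs
            (λ agree → w≢v (sym (val-injective u v w agree)))

∈-sublists⇒⊆ : ∀ cs {D} → D ∈ sublists cs → All (_∈ cs) D
∈-sublists⇒⊆ []       (here refl) = []
∈-sublists⇒⊆ (c ∷ cs) D∈ with ∈-++⁻ (map (c ∷_) (sublists cs)) D∈
... | inj₂ D∈′ = All.map there (∈-sublists⇒⊆ cs D∈′)
... | inj₁ D∈′ with ∈-map⁻ (c ∷_) D∈′
...   | D′ , D′∈ , refl = here refl ∷ All.map there (∈-sublists⇒⊆ cs D′∈)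

∈⇒≤-foldr-⊔ : ∀ {n ns} → n ∈ ns → n ≤ foldr _⊔_ 0 ns
∈⇒≤-foldr-⊔ {ns = m ∷ ns} (here refl) = m≤m⊔n m _
∈⇒≤-foldr-⊔ {ns = m ∷ ns} (there n∈) = m≤n⇒m≤o⊔n m (∈⇒≤-foldr-⊔ n∈)

unique-map⇒injective : ∀ {A B : Set} {f : A → B} {xs} → Unique (map f xs) →
                       ∀ {x y} → x ∈ xs → y ∈ xs → f x ≡ f y → x ≡ y
unique-map⇒injective (_ ∷ _)   (here refl) (here refl) _ = refl
unique-map⇒injective (fx∉ ∷ _) (here refl) (there y∈) e =
  contradiction e (All.lookup fx∉ (∈-map⁺ _ y∈))
unique-map⇒injective (fy∉ ∷ _) (there x∈) (here refl) e =
  contradiction (sym e) (All.lookup fy∉ (∈-map⁺ _ x∈))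
unique-map⇒injective (_ ∷ u)   (there x∈) (there y∈) e = unique-map⇒injective u x∈ y∈ e

uniform-or-positive : ∀ {k} (T : Table k) → Uniform T ⊎ ∃ λ r → r ∈ rows T × proj₂ r ≡ one
uniform-or-positive T with all? (λ r → proj₂ r Fin.≟ zero) (rows T)
... | yes all-zero = inj₁ (zero , all-zero)
... | no ¬all-zero with find (¬All⇒Any¬ (λ r → proj₂ r Fin.≟ zero) (rows T) ¬all-zero)
...   | (_ , suc zero) , r∈ , _  = inj₂ (_ , r∈ , refl)
...   | (_ , zero)     , _  , ≢0 = contradiction refl ≢0

chain : ∀ {k} → Fin 2 → List (ℕ × Fin k) → Node k
chain d []            = leaf d
chain d ((f , δ) ∷ p) = attr f ((δ , chain d p) ∷ [])

NPath-chain : ∀ {k} d (p : List (ℕ × Fin k)) → NPath (chain d p) p d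
NPath-chain d []            = leafP
NPath-chain d ((f , δ) ∷ p) = attrP (here refl) (NPath-chain d p)

NPath-chain⁻ : ∀ {k d d′} (p : List (ℕ × Fin k)) {q} → NPath (chain d p) q d′ → q ≡ p × d′ ≡ d
NPath-chain⁻ []            leafP                  = refl , refl
NPath-chain⁻ ((f , δ) ∷ p) (attrP (here refl) np) with NPath-chain⁻ p np
... | refl , d′≡d = refl , d′≡d

fan : ∀ {k} → Fin 2 → List⁺ (List (ℕ × Fin k)) → DTree k
fan d ps = List⁺.map (chain d) ps

CPath-fan : ∀ {k d} (ps : List⁺ (List (ℕ × Fin k))) {p} → p ∈ toList ps → CPath (fan d ps) p d
CPath-fan {d = d} (p₀ ∷ ps) {p} p∈ = chain d p , ∈-map⁺ (chain d) p∈ , NPath-chain d p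

CPath-fan⁻ : ∀ {k d d′} (ps : List⁺ (List (ℕ × Fin k))) {p} → CPath (fan d ps) p d′ →
             p ∈ toList ps × d′ ≡ d
CPath-fan⁻ {d = d} (p₀ ∷ ps) (c , c∈ , np) with ∈-map⁻ (chain d) {xs = p₀ ∷ ps} c∈
... | q , q∈ , refl with NPath-chain⁻ q np
...   | refl , d′≡d = q∈ , d′≡d

module _ {k : ℕ} (T : Table k) where

  has? : ∀ f δ (r : Row k (length (cols T))) → Dec (val (cols T) (proj₁ r) f ≡ just δ)
  has? f δ r = maybe-≡-dec Fin._≟_ (val (cols T) (proj₁ r) f) (just δ)

  Matches : Vec (Fin k) (length (cols T)) → List (ℕ × Fin k) → Set
  Matches v p = All (λ (f , δ) → val (cols T) v f ≡ just δ) p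

  ∈-restrict⁻ : ∀ p {r} → r ∈ restrict T p → r ∈ rows T × Matches (proj₁ r) p
  ∈-restrict⁻ []            r∈ = r∈ , []
  ∈-restrict⁻ ((f , δ) ∷ p) r∈
    with ∈-filter⁻ (has? f δ) {xs = restrict T p} r∈
  ... | r∈′ , e with ∈-restrict⁻ p r∈′
  ...   | r∈rows , m = r∈rows , e ∷ m

  ∈-restrict⁺ : ∀ p {r} → r ∈ rows T → Matches (proj₁ r) p → r ∈ restrict T p
  ∈-restrict⁺ []            r∈ []      = r∈
  ∈-restrict⁺ ((f , δ) ∷ p) r∈ (e ∷ m) =
    ∈-filter⁺ (has? f δ) (∈-restrict⁺ p r∈ m) e

  Agree : Row k (length (cols T)) → Row k (length (cols T)) → List ℕ → Set
  Agree r r′ D = All (λ f → val (cols T) (proj₁ r) f ≡ val (cols T) (proj₁ r′) f) D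

  separated-row-unique : ∀ {r r′ D} → Separates T r D → r ∈ rows T → r′ ∈ rows T →
                         Agree r r′ D → r′ ≡ r
  separated-row-unique {r} {r′} sep r∈ r′∈ agree =
    unique-map⇒injective (rowsU T) r′∈ r∈
      (decidable-stable (vec-≡-dec Fin._≟_ (proj₁ r′) (proj₁ r))
        (λ r′≢r → All¬⇒¬Any (All.map (λ e ne → ne e) agree) (All.lookup sep r′∈ r′≢r)))

  module _ (M : ComplexityMeasure) where

    optimal-separator : ∀ r → ∃ λ D → Separates T r D × All (_∈ cols T) D × ψ M D ≤ Sψrow M T r
    optimal-separator r
      with foldr-selective ⊓-sel (ψ M (cols T))
             (map (ψ M) (filter (separates? T r) (sublists (cols T))))
    ... | inj₁ Sψrow≡ =
      cols T , All.tabulate (λ _ → cols-separate (colsU T)) , All.tabulate id , ≤-reflexive (sym Sψrow≡)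
    ... | inj₂ Sψrow∈ with ∈-map⁻ (ψ M) Sψrow∈
    ...   | D , D∈ , Sψrow≡ with ∈-filter⁻ (separates? T r) {xs = sublists (cols T)} D∈
    ...     | D∈sublists , sep =
      D , sep , ∈-sublists⇒⊆ (cols T) D∈sublists , ≤-reflexive (sym Sψrow≡)

    Sψrow≤Sψ : ∀ {r} → r ∈ rows T → Sψrow M T r ≤ Sψ M T
    Sψrow≤Sψ r∈ = ∈⇒≤-foldr-⊔ (∈-map⁺ (Sψrow M T) r∈)

module WitnessTree {k : ℕ} (M : ComplexityMeasure) (T : Table (suc k)) where

  Rw : Set
  Rw = Row (suc k) (length (cols T))

  -- `zero` is a junk default: values are only read at columns of T.
  value : Rw → ℕ → Fin (suc k)
  value r f = fromMaybe zero (val (cols T) (proj₁ r) f)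

  trace : Rw → List ℕ → List (ℕ × Fin (suc k))
  trace r D = map (λ f → f , value r f) D

  F-trace : ∀ r D → F (trace r D) ≡ D
  F-trace r D = trans (sym (map-∘ D)) (map-id D)

  matches-trace : ∀ r {D} → All (_∈ cols T) D → Matches T (proj₁ r) (trace r D)
  matches-trace r D⊆ = map⁺ (All.map (∈⇒val≡just zero (cols T) (proj₁ r)) D⊆)

  matches-trace⇒agree : ∀ r r′ {D} → All (_∈ cols T) D → Matches T (proj₁ r′) (trace r D) →
                        Agree T r r′ D
  matches-trace⇒agree r r′ D⊆ m =
    All.zipWith (λ (f∈ , e) → trans (∈⇒val≡just zero (cols T) (proj₁ r) f∈) (sym e)) (D⊆ , map⁻ m)

  separator : Rw → List ℕ
  separator r = proj₁ (optimal-separator T M r)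

  separator⊆cols : ∀ r → All (_∈ cols T) (separator r)
  separator⊆cols r = proj₁ (proj₂ (proj₂ (optimal-separator T M r)))

  witnessPath : Rw → List (ℕ × Fin (suc k))
  witnessPath r = trace r (separator r)

  witnessPath-covers : ∀ {r} → r ∈ rows T → r ∈ restrict T (witnessPath r)
  witnessPath-covers {r} r∈ = ∈-restrict⁺ T (witnessPath r) r∈ (matches-trace r (separator⊆cols r))

  witnessPath-isolates : ∀ {r r′} → r ∈ rows T → r′ ∈ restrict T (witnessPath r) → r′ ≡ r
  witnessPath-isolates {r} {r′} r∈ r′∈ with ∈-restrict⁻ T (witnessPath r) r′∈
  ... | r′∈rows , m = separated-row-unique T (proj₁ (proj₂ (optimal-separator T M r))) r∈ r′∈rows
                        (matches-trace⇒agree r r′ (separator⊆cols r) m)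

  F-witnessPath⊆cols : ∀ r → All (_∈ cols T) (F (witnessPath r))
  F-witnessPath⊆cols r = subst (All (_∈ cols T)) (sym (F-trace r (separator r))) (separator⊆cols r)

  ψ-witnessPath≤Sψ : ∀ {r} → r ∈ rows T → ψ M (F (witnessPath r)) ≤ Sψ M T
  ψ-witnessPath≤Sψ {r} r∈ =
    subst (λ D → ψ M D ≤ Sψ M T) (sym (F-trace r (separator r)))
      (≤-trans (proj₂ (proj₂ (proj₂ (optimal-separator T M r)))) (Sψrow≤Sψ T M r∈))

  positive? : (r : Rw) → Dec (proj₂ r ≡ one)
  positive? r = proj₂ r Fin.≟ one

  positives : List Rw
  positives = filter positive? (rows T)

  module _ (r₀ : Rw) (r₀∈ : r₀ ∈ rows T) (r₀+ : proj₂ r₀ ≡ one) where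

    -- r₀ only makes the list of root edges nonempty; its branch repeats one in `positives`.
    witnessPaths : List⁺ (List (ℕ × Fin (suc k)))
    witnessPaths = List⁺.map witnessPath (r₀ ∷ positives)

    witnessTree : DTree (suc k)
    witnessTree = fan one witnessPaths

    CPath-witnessTree⁻ : ∀ {p d} → CPath witnessTree p d →
                         d ≡ one × ∃ λ r → r ∈ rows T × proj₂ r ≡ one × p ≡ witnessPath r
    CPath-witnessTree⁻ cp with CPath-fan⁻ witnessPaths cp
    ... | p∈ , d≡one with ∈-map⁻ witnessPath {xs = r₀ ∷ positives} p∈
    ...   | r , here refl , p≡ = d≡one , r₀ , r₀∈ , r₀+ , p≡
    ...   | r , there r∈positives , p≡ with ∈-filter⁻ positive? {xs = rows T} r∈positives
    ...     | r∈ , r+ = d≡one , r , r∈ , r+ , p≡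

    witnessTree-stronglyNondet : StronglyNondet T witnessTree
    witnessTree-stronglyNondet = leaves-one , attributes-of-T , covers , positive-ends
      where
      leaves-one : ∀ p d → CPath witnessTree p d → d ≡ one
      leaves-one p d cp = proj₁ (CPath-witnessTree⁻ cp)

      attributes-of-T : ∀ p d → CPath witnessTree p d → All (_∈ cols T) (F p)
      attributes-of-T p d cp with CPath-witnessTree⁻ cp
      ... | _ , r , _ , _ , refl = F-witnessPath⊆cols r

      covers : ∀ r → r ∈ rows T → proj₂ r ≡ one →
               ∃ λ p → ∃ λ d → CPath witnessTree p d × r ∈ restrict T p
      covers r r∈ r+ =
        witnessPath r , one ,
        CPath-fan witnessPaths (there (∈-map⁺ witnessPath (∈-filter⁺ positive? r∈ r+))) ,
        witnessPath-covers r∈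

      positive-ends : ∀ p d → CPath witnessTree p d → All (λ r′ → proj₂ r′ ≡ one) (restrict T p)
      positive-ends p d cp with CPath-witnessTree⁻ cp
      ... | _ , r , r∈ , r+ , refl =
        All.tabulate (λ r′∈ → trans (cong proj₂ (witnessPath-isolates r∈ r′∈)) r+)

    ψ-witnessTree≤Sψ : ψΓ≤ M witnessTree (Sψ M T)
    ψ-witnessTree≤Sψ p d cp with CPath-witnessTree⁻ cp
    ... | _ , r , r∈ , _ , refl = ψ-witnessPath≤Sψ r∈

lemma9 : (k : ℕ) → 2 ≤ k → (M : ComplexityMeasure) → (T : Table k) →
    ψs≤ M T (Sψ M T)
lemma9 (suc (suc k)) (s≤s (s≤s z≤n)) M T with uniform-or-positive T
... | inj₁ uniform         = inj₁ uniform
... | inj₂ (r₀ , r₀∈ , r₀+) =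
  inj₂ ( witnessTree r₀ r₀∈ r₀+
       , witnessTree-stronglyNondet r₀ r₀∈ r₀+
       , ψ-witnessTree≤Sψ r₀ r₀∈ r₀+ )
  where open WitnessTree M T
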